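{- For every clean $\mathrm{FO}_{\exists,\land}$-formula $\varphi$, every tuple of distinct variables $\overline{y}=y_1,\dots,y_n$ with each $y_i$ a free variable of $\varphi$, and every tuple of unary predicates $\overline{P}=P_1,\dots,P_n$, we have $$\Big(\bigwedge_{i=1}^n P_i(y_i)\Big)\models \varphi\to\mathsf{BIND}_{\overline{y}\mapsto\overline{P}}(\varphi),$$ i.e. for every structure $M$ and assignment $g$, if $M,g\models\bigwedge_i P_i(y_i)$ and $M,g\models\varphi$, then $M,g\models\mathsf{BIND}_{\overline{y}\mapsto\overline{P}}(\varphi)$.
   Context: Signatures are relational. $\mathrm{FO}_{\exists,\land}$ is generated by $\varphi ::= R(x_1,\dots,x_k)\mid x=y\mid\varphi\land\varphi\mid\exists x\varphi$. A formula is clean if no free variable of it also occurs bound in it, and it does not contain two quantifiers for the same variable. For an $\mathrm{FO}_{\exists,\land}$-formula $\varphi$, a tuple $\overline{y}=y_1,\dots,y_n$ of distinct variables and unary predicates $\overline{P}=P_1,\dots,P_n$, $\mathsf{BIND}_{\overline{y}\mapsto\overline{P}}(\varphi)$ is defined recursively: for an atomic formula $\alpha$ (possibly an equality), $\mathsf{BIND}_{\overline{y}\mapsto\overline{P}}(\alpha)=\exists\overline{y}'\big(\alpha\land\bigwedge_{1\le i\le n,\ y_i\in\mathrm{free}(\alpha)}P_i(y_i)\big)$, where $\overline{y}'$ is the restriction of $\overline{y}$ to variables occurring in $\alpha$ (and $\mathsf{BIND}_{\overline{y}\mapsto\overline{P}}(\alpha)=\alpha$ if no variable of $\overline{y}$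 occurs in $\alpha$); $\mathsf{BIND}_{\overline{y}\mapsto\overline{P}}(\varphi\land\psi)=\mathsf{BIND}_{\overline{y}\mapsto\overline{P}}(\varphi)\land\mathsf{BIND}_{\overline{y}\mapsto\overline{P}}(\psi)$; $\mathsf{BIND}_{\overline{y}\mapsto\overline{P}}(\exists z\psi)=\exists z\,\mathsf{BIND}_{\overline{y}\mapsto\overline{P}}(\psi)$. -}

module Defs where

open import Data.Nat using (ℕ; _≟_)
open import Data.Fin using (Fin)
open import Data.List using (List; []; _∷_; _++_; filter; foldr; allFin)
open import Data.List.Membership.Propositional using (_∈_; _∉_)
open import Data.List.Membership.DecPropositional _≟_ using (_∈?_)
open import Data.List.Relation.Unary.Unique.Propositional using (Unique)
open import Data.Vec using (Vec; toList; map; [_])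
open import Data.Product using (Σ; _×_)
open import Data.Sum using (_⊎_)
open import Relation.Binary.PropositionalEquality using (_≡_; _≢_)
open import Relation.Nullary using (yes; no)

Var : Set
Var = ℕ

data Formula (Sym : ℕ → Set) : Set where
  rel : ∀ {k} → Sym k → Vec Var k → Formula Sym
  eq  : Var → Var → Formula Sym
  and : Formula Sym → Formula Sym → Formula Sym
  ex  : Var → Formula Sym → Formula Sym

module _ {Sym : ℕ → Set} where

  Free : Var → Formula Sym → Set
  Free x (rel R xs) = x ∈ toList xs
  Free x (eq a b)   = x ≡ a ⊎ x ≡ b
  Free x (and φ ψ)  = Free x φ ⊎ Free x ψ
  Free x (ex y φ)   = x ≢ y × Free x φ

  bvars : Formula Sym → List Var
  bvars (rel R xs) = []
  bvars (eq a b)   = []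
  bvars (and φ ψ)  = bvars φ ++ bvars ψ
  bvars (ex y φ)   = y ∷ bvars φ

  Clean : Formula Sym → Set
  Clean φ = Unique (bvars φ) × (∀ x → Free x φ → x ∉ bvars φ)

  -- BIND_{y ↦ P} for an atom α with variable list vs:
  -- ∃ y' (α ∧ ⋀_{y_i ∈ vars α} P_i(y_i)), y' = restriction of y (in order) to vars α;
  -- equals α when no y_i occurs in α.
  bindAtom : ∀ {n} → (Fin n → Var) → (Fin n → Sym 1) →
             Formula Sym → List Var → Formula Sym
  bindAtom {n} y P α vs =
    foldr (λ i acc → ex (y i) acc)
          (foldr (λ i acc → and acc (rel (P i) [ y i ])) α idx)
          idx
    where
      idx : List (Fin n)
      idx = filter (λ i → y i ∈? vs) (allFin n)

  BIND : ∀ {n} → (Fin n → Var) → (Fin n → Sym 1) → Formula Sym → Formula Sym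
  BIND y P α@(rel R xs) = bindAtom y P α (toList xs)
  BIND y P α@(eq a b)   = bindAtom y P α (a ∷ b ∷ [])
  BIND y P (and φ ψ)    = and (BIND y P φ) (BIND y P ψ)
  BIND y P (ex z φ)     = ex z (BIND y P φ)

record Structure (Sym : ℕ → Set) : Set₁ where
  field
    Dom    : Set
    interp : ∀ {k} → Sym k → Vec Dom k → Set

open Structure public

module _ {Sym : ℕ → Set} (M : Structure Sym) where

  Assignment : Set
  Assignment = Var → Dom M

  _[_↦_] : Assignment → Var → Dom M → Assignment
  (g [ x ↦ d ]) z with z ≟ x
  ... | yes _ = d
  ... | no  _ = g z

  Sat : Assignment → Formula Sym → Set
  Sat g (rel R xs) = interp M R (map g xs)
  Sat g (eq a b)   = g a ≡ g b
  Sat g (and φ ψ)  = Sat g φ × Sat g ψ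
  Sat g (ex x φ)   = Σ (Dom M) (λ d → Sat (g [ x ↦ d ]) φ)

{-# OPTIONS --safe #-}
module Submission where

-- BIND only adds existential quantifiers over the yᵢ, which are witnessed by
-- their current values, and conjuncts Pᵢ(yᵢ), which hold by hypothesis.  The
-- hypotheses survive the descent under the quantifiers of φ because cleanness
-- makes the free variables yᵢ distinct from every bound variable, so the
-- updated assignments never touch them.

open import Defs
open import Data.Nat using (ℕ; _≟_)
open import Data.Fin using (Fin)
open import Data.Vec using (_∷_; [])
open import Data.Vec.Properties using (map-cong)
open import Data.List using (List; []; _∷_; foldr; filter; allFin)
open import Data.List.Membership.Propositional using (_∉_)
open import Data.List.Membership.Propositional.Properties using (∈-++⁺ˡ; ∈-++⁺ʳ)
open import Data.List.Membership.DecPropositional _≟_ using (_∈?_)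
open import Data.List.Relation.Unary.Any using (here; there)
open import Data.Product using (_,_; proj₂)
open import Data.Empty using (⊥-elim)
open import Function.Definitions using (Injective)
open import Relation.Nullary using (yes; no)
open import Relation.Binary.PropositionalEquality
  using (_≡_; _≢_; refl; sym; trans; subst)

module _ {Sym : ℕ → Set} (M : Structure Sym) where

  _≗ₐ_ : Assignment M → Assignment M → Set
  g ≗ₐ h = ∀ z → g z ≡ h z

  [↦]-cong : ∀ {g h} → g ≗ₐ h → ∀ x d → _[_↦_] M g x d ≗ₐ _[_↦_] M h x d
  [↦]-cong g≗h x d z with z ≟ x
  ... | yes _ = refl
  ... | no  _ = g≗h z

  [↦]-self : ∀ g x → _[_↦_] M g x (g x) ≗ₐ g
  [↦]-self g x z with z ≟ x
  ... | yes refl = refl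
  ... | no  _    = refl

  [↦]-other : ∀ g x d {z} → z ≢ x → _[_↦_] M g x d z ≡ g z
  [↦]-other g x d {z} z≢x with z ≟ x
  ... | yes z≡x = ⊥-elim (z≢x z≡x)
  ... | no  _   = refl

  Sat-cong : ∀ φ {g h} → g ≗ₐ h → Sat M g φ → Sat M h φ
  Sat-cong (rel R xs) g≗h s       = subst (interp M R) (map-cong g≗h xs) s
  Sat-cong (eq a b)   g≗h s       = trans (sym (g≗h a)) (trans s (g≗h b))
  Sat-cong (and φ ψ)  g≗h (s , t) = Sat-cong φ g≗h s , Sat-cong ψ g≗h t
  Sat-cong (ex x φ)   g≗h (d , s) = d , Sat-cong φ ([↦]-cong g≗h x d) s

  Sat-rel₁-[↦]-other : ∀ {g} (Q : Sym 1) {z} x d → z ≢ x →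
                       Sat M g (rel Q (z ∷ [])) → Sat M (_[_↦_] M g x d) (rel Q (z ∷ []))
  Sat-rel₁-[↦]-other {g} Q x d z≢x =
    subst (λ v → interp M Q (v ∷ [])) (sym ([↦]-other g x d z≢x))

  module _ {n : ℕ} (y : Fin n → Var) (P : Fin n → Sym 1) where

    Sat-∃-self : ∀ {g} body (is : List (Fin n)) →
                 Sat M g body → Sat M g (foldr (λ i acc → ex (y i) acc) body is)
    Sat-∃-self         body []       s = s
    Sat-∃-self {g = g} body (i ∷ is) s =
      g (y i) , Sat-cong (foldr (λ i acc → ex (y i) acc) body is)
                         (λ z → sym ([↦]-self g (y i) z))
                         (Sat-∃-self body is s)

    Sat-∧-guards : ∀ {g} body (is : List (Fin n)) →
                   (∀ i → Sat M g (rel (P i) (y i ∷ []))) →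
                   Sat M g body →
                   Sat M g (foldr (λ i acc → and acc (rel (P i) (y i ∷ []))) body is)
    Sat-∧-guards body []       guards s = s
    Sat-∧-guards body (i ∷ is) guards s = Sat-∧-guards body is guards s , guards i

    Sat-bindAtom : ∀ {g} α vs → (∀ i → Sat M g (rel (P i) (y i ∷ []))) →
                   Sat M g α → Sat M g (bindAtom y P α vs)
    Sat-bindAtom α vs guards s =
      Sat-∃-self _ idx (Sat-∧-guards α idx guards s)
      where
        idx : List (Fin n)
        idx = filter (λ i → y i ∈? vs) (allFin n)

    Sat-BIND : ∀ φ {g} → (∀ i → y i ∉ bvars φ) →
               (∀ i → Sat M g (rel (P i) (y i ∷ []))) →
               Sat M g φ → Sat M g (BIND y P φ)
    Sat-BIND (rel R xs) unbound guards s = Sat-bindAtom (rel R xs) _ guards s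
    Sat-BIND (eq a b)   unbound guards s = Sat-bindAtom (eq a b) _ guards s
    Sat-BIND (and φ ψ)  unbound guards (s , t) =
      Sat-BIND φ (λ i m → unbound i (∈-++⁺ˡ m)) guards s ,
      Sat-BIND ψ (λ i m → unbound i (∈-++⁺ʳ (bvars φ) m)) guards t
    Sat-BIND (ex z φ)   unbound guards (d , s) =
      d , Sat-BIND φ (λ i m → unbound i (there m))
                     (λ i → Sat-rel₁-[↦]-other (P i) z d (λ e → unbound i (here e)) (guards i))
                     s

proposition10 : {Sym : ℕ → Set} (φ : Formula Sym) → Clean φ →
    (n : ℕ) (y : Fin n → Var) → Injective _≡_ _≡_ y → (∀ i → Free (y i) φ) →
    (P : Fin n → Sym 1) →
    (M : Structure Sym) (g : Assignment M) →
    (∀ i → Sat M g (rel (P i) (y i ∷ []))) →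
    Sat M g φ → Sat M g (BIND y P φ)
proposition10 φ clean n y _ free P M g guards s =
  Sat-BIND M y P φ (λ i → proj₂ clean (y i) (free i)) guards s
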